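{- Let $\mathcal F$ be a set of function symbols with arities, equipped with a precedence $\ge_{\mathcal F}$ and statuses as described in the context, and let $>_{rco}$ be the first-order recursive computability ordering (the least fixpoint of the map $\mathrm{CR}$ defined in the context). Then $>_{rco}$ is transitive, is a rewrite relation (i.e. is stable by substitution and by context), and contains the strict subterm relation $\rhd$ (i.e. $t\rhd u$ implies $t>_{rco}u$).
   Context: First-order setting: $\mathcal X$ is a set of variables and $\mathcal F$ a disjoint set of function symbols with arities; $\mathcal T$ is the set of first-order algebraic terms built from $\mathcal F$ and $\mathcal X$. $\rhd$ denotes the strict subterm relation. A relation $>$ on terms is stable by substitution if $t\theta>u\theta$ whenever $t>u$, stable by context if $C[t]_p>C[u]_p$ whenever $t>u$, and a rewrite relation if it is both. For a relation $R$ on terms, $\rightarrow_R$ is the smallest rewrite relation containing $R$ and $\rightarrow_R^+$ its transitive closure. A precedence $\ge_{\mathcal F}$ is a quasi-ordering on $\mathcal F$ whose strict part $>_{\mathcal F}$ is well-founded; $\simeq_{\mathcal F}$ is its associated equivalence. Each $f\in\mathcal F$ has a status $\mathrm{stat}_f\in\{\mathrm{lex},\mathrm{mul}\}$, with $\mathrm{stat}_f=\mathrm{stat}_g$ whenever $f\simeq_{\mathcal F}g$; for a relation $>$ on terms, $>_{\mathrm{stat}_f}$ is its extension to finite sequences of terms: the lexicographic extension (in a fixed left-to-right or right-to-left order) if $\mathrm{stat}_f=\mathrm{lex}$, the multiset extension if $\mathrm{stat}_f=\mathrm{mul}$. Computability closure: for a relation $R$ on terms and a term $f\vec t=f t_1\dots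 t_n$, the set $\mathrm{CC}_R^f(\vec t)$ is the least set of terms such that: (arg) $t_i\in\mathrm{CC}_R^f(\vec t)$ for every $i$; (decomp) if $g u_1\dots u_m\in\mathrm{CC}_R^f(\vec t)$ then each $u_i\in\mathrm{CC}_R^f(\vec t)$; (prec) if $f>_{\mathcal F}g$ and $u_1,\dots,u_m\in\mathrm{CC}_R^f(\vec t)$ then $g u_1\dots u_m\in\mathrm{CC}_R^f(\vec t)$; (call) if $f\simeq_{\mathcal F}g$, $u_1,\dots,u_m\in\mathrm{CC}_R^f(\vec t)$ and $(t_1,\dots,t_n)\,(\rightarrow_R^+\cup\rhd)_{\mathrm{stat}_f}\,(u_1,\dots,u_m)$ then $g u_1\dots u_m\in\mathrm{CC}_R^f(\vec t)$; (red) if $u\in\mathrm{CC}_R^f(\vec t)$ and $u\rightarrow_R^+v$ then $v\in\mathrm{CC}_R^f(\vec t)$. $\mathrm{CR}(R)$ is the set of pairs $(f\vec t,u)$ with $u\in\mathrm{CC}_R^f(\vec t)$. The map $\mathrm{CR}$ is monotone and $\omega$-sup-continuous for inclusion; $>_{rco}$ denotes its least fixpoint (the first-order recursive computability ordering). -}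

module Defs where

open import Level using (0ℓ)
open import Data.Nat using (ℕ; zero; suc)
open import Data.Fin using (Fin)
open import Data.Vec using (Vec; []; _∷_; lookup; _[_]≔_; toList)
open import Data.List using (List; []; _∷_; _++_; reverse)
open import Data.List.Membership.Propositional using (_∈_)
open import Data.List.Relation.Binary.Permutation.Propositional using (_↭_)
open import Data.Product using (Σ; ∃; _×_; _,_)
open import Data.Sum using (_⊎_)
open import Data.Empty using (⊥)
open import Relation.Nullary using (¬_)
open import Relation.Binary using (Rel; IsPreorder; Transitive)
open import Relation.Binary.PropositionalEquality using (_≡_)
open import Relation.Binary.Construct.Closure.Transitive using (TransClosure)
open import Induction.WellFounded using (WellFounded)

data Status : Set where
  lex mul : Status

data LexDir : Set where
  left-to-right right-to-left : LexDir

record Setting : Set₁ where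
  field
    Var    : Set
    Sym    : Set
    arity  : Sym → ℕ
    _≥F_   : Rel Sym 0ℓ
    ≥F-isPreorder : IsPreorder _≡_ _≥F_
    >F-wf  : WellFounded (λ g f → (f ≥F g) × ¬ (g ≥F f))
    stat   : Sym → Status
    stat-compat : ∀ {f g} → f ≥F g → g ≥F f → stat f ≡ stat g
    lexDir : LexDir

module RCO (S : Setting) where
  open Setting S

  _>F_ : Rel Sym 0ℓ
  f >F g = (f ≥F g) × ¬ (g ≥F f)

  _≃F_ : Rel Sym 0ℓ
  f ≃F g = (f ≥F g) × (g ≥F f)

  data Term : Set where
    var : Var → Term
    app : (f : Sym) → Vec Term (arity f) → Term

  Subst : Set
  Subst = Var → Term

  mutual
    _⟨_⟩ : Term → Subst → Term
    var x    ⟨ σ ⟩ = σ x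
    app f ts ⟨ σ ⟩ = app f (substs ts σ)

    substs : ∀ {n} → Vec Term n → Subst → Vec Term n
    substs []       σ = []
    substs (t ∷ ts) σ = (t ⟨ σ ⟩) ∷ substs ts σ

  data Ctx : Set where
    hole : Ctx
    node : (f : Sym) (ts : Vec Term (arity f)) (i : Fin (arity f)) → Ctx → Ctx

  plug : Ctx → Term → Term
  plug hole         t = t
  plug (node f ts i C) t = app f (ts [ i ]≔ plug C t)

  StableSubst : Rel Term 0ℓ → Set
  StableSubst _>_ = ∀ (σ : Subst) {t u} → t > u → (t ⟨ σ ⟩) > (u ⟨ σ ⟩)

  StableCtx : Rel Term 0ℓ → Set
  StableCtx _>_ = ∀ (C : Ctx) {t u} → t > u → plug C t > plug C u

  data _▷₁_ : Rel Term 0ℓ where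
    sub : ∀ f (ts : Vec Term (arity f)) (i : Fin (arity f)) → app f ts ▷₁ lookup ts i

  _▷_ : Rel Term 0ℓ
  _▷_ = TransClosure _▷₁_

  data Step (R : Rel Term 0ℓ) : Rel Term 0ℓ where
    root : ∀ {l r} (σ : Subst) → R l r → Step R (l ⟨ σ ⟩) (r ⟨ σ ⟩)
    cong : ∀ {t u} f (ts : Vec Term (arity f)) (i : Fin (arity f)) →
           Step R t u → Step R (app f (ts [ i ]≔ t)) (app f (ts [ i ]≔ u))

  Step⁺ : Rel Term 0ℓ → Rel Term 0ℓ
  Step⁺ R = TransClosure (Step R)

  data Lex (_>_ : Rel Term 0ℓ) : Rel (List Term) 0ℓ where
    here  : ∀ {a b as bs} → a > b → Lex _>_ (a ∷ as) (b ∷ bs)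
    there : ∀ {a as bs} → Lex _>_ as bs → Lex _>_ (a ∷ as) (a ∷ bs)

  LexDirected : Rel Term 0ℓ → Rel (List Term) 0ℓ
  LexDirected _>_ with lexDir
  ... | left-to-right = Lex _>_
  ... | right-to-left = λ xs ys → Lex _>_ (reverse xs) (reverse ys)

  -- multiset extension (Dershowitz–Manna), multisets as lists up to permutation
  Mul : Rel Term 0ℓ → Rel (List Term) 0ℓ
  Mul _>_ M N = Σ (List Term) λ X → Σ (List Term) λ Y → Σ (List Term) λ Z →
      (M ↭ (X ++ Z)) × (N ↭ (Y ++ Z)) × ¬ (X ≡ []) ×
      (∀ {y} → y ∈ Y → Σ Term λ x → (x ∈ X) × (x > y))

  Ext : Status → Rel Term 0ℓ → Rel (List Term) 0ℓ
  Ext lex = LexDirected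
  Ext mul = Mul

  RedSub : Rel Term 0ℓ → Rel Term 0ℓ
  RedSub R t u = Step⁺ R t u ⊎ t ▷ u

  data CC (R : Rel Term 0ℓ) (f : Sym) (ts : Vec Term (arity f)) : Term → Set where
    arg    : (i : Fin (arity f)) → CC R f ts (lookup ts i)
    decomp : ∀ {g} {us : Vec Term (arity g)} → CC R f ts (app g us) →
             (i : Fin (arity g)) → CC R f ts (lookup us i)
    prec   : ∀ {g} (us : Vec Term (arity g)) → f >F g →
             (∀ i → CC R f ts (lookup us i)) → CC R f ts (app g us)
    call   : ∀ {g} (us : Vec Term (arity g)) → f ≃F g →
             (∀ i → CC R f ts (lookup us i)) →
             Ext (stat f) (RedSub R) (toList ts) (toList us) → CC R f ts (app g us)
    red    : ∀ {u v} → CC R f ts u → Step⁺ R u v → CC R f ts v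

  data CR (R : Rel Term 0ℓ) : Rel Term 0ℓ where
    cr : ∀ {f} {ts : Vec Term (arity f)} {u} → CC R f ts u → CR R (app f ts) u

  -- >_rco : the least fixpoint of CR, as the inductive type generated by
  -- R ↦ CR R (least prefixpoint = least fixpoint of the monotone map CR)
  data _>rco_ : Rel Term 0ℓ where
    fix : ∀ {t u} → CR _>rco_ t u → t >rco u

{-# OPTIONS --safe #-}
-- Each property already holds of CR R for an arbitrary relation R, because the
-- computability closure is closed under the corresponding operations.
-- Substituting σ into a derivation of u ∈ CC_R^f(t⃗) gives one of uσ ∈ CC_R^f(t⃗σ),
-- since →_R^+ and ▷ are stable by substitution, and so are their lexicographic and
-- multiset extensions compared in (call).  Rule (red) appends an R-step, so
-- CR R ; R ⊆ CR R.  Rules (arg) and (decomp) reach every subterm.  Rule (call) with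
-- g = f, comparing the argument lists by a single R-step in one position, gives
-- monotonicity under a one-layer context.  As >rco = CR(>rco), transitivity
-- follows, and monotonicity extends to all contexts by induction on the context.
module Submission where

open import Defs
open import Data.Product using (Σ; _×_; _,_)
open import Data.Sum using (inj₁; inj₂)
open import Data.Fin using (zero; suc)
open import Data.Fin.Properties using (_≟_)
open import Data.Vec using (Vec; []; _∷_; lookup; _[_]≔_; toList)
import Data.Vec as Vec
open import Data.Vec.Properties using (lookup-map; map-[]≔; toList-map; lookup∘update; lookup∘update′)
open import Data.List using (List; []; _∷_; _++_; reverse; map)
open import Data.List.Properties using (reverse-++; unfold-reverse; ++-assoc; map-++; reverse-map)
open import Data.List.Membership.Propositional using (_∈_)
open import Data.List.Membership.Propositional.Properties using (∈-map⁺; ∈-map⁻)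
open import Data.List.Relation.Unary.Any using (here)
open import Data.List.Relation.Binary.Permutation.Propositional using (_↭_)
open import Data.List.Relation.Binary.Permutation.Propositional.Properties using (shift; map⁺)
open import Relation.Nullary using (¬_; yes; no)
open import Relation.Binary using (Rel; IsPreorder; Transitive)
open import Relation.Binary.PropositionalEquality
  using (_≡_; refl; sym; trans; cong₂; subst; subst₂; module ≡-Reasoning)
import Relation.Binary.PropositionalEquality as Eq
open import Relation.Binary.Construct.Closure.Transitive using ([_]; _∷_)
open import Level using (0ℓ)

module Properties (S : Setting) where
  open Setting S
  open RCO S

  ≃F-refl : ∀ {f} → f ≃F f
  ≃F-refl = IsPreorder.refl ≥F-isPreorder , IsPreorder.refl ≥F-isPreorder

  _⨾_ : Subst → Subst → Subst
  (σ ⨾ τ) x = σ x ⟨ τ ⟩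

  mutual
    ⟨⟩-var : ∀ t → t ⟨ var ⟩ ≡ t
    ⟨⟩-var (var x)    = refl
    ⟨⟩-var (app f ts) = Eq.cong (app f) (substs-var ts)

    substs-var : ∀ {n} (ts : Vec Term n) → substs ts var ≡ ts
    substs-var []       = refl
    substs-var (t ∷ ts) = cong₂ _∷_ (⟨⟩-var t) (substs-var ts)

  mutual
    ⟨⟩-⨾ : ∀ t σ τ → t ⟨ σ ⟩ ⟨ τ ⟩ ≡ t ⟨ σ ⨾ τ ⟩
    ⟨⟩-⨾ (var x)    σ τ = refl
    ⟨⟩-⨾ (app f ts) σ τ = Eq.cong (app f) (substs-⨾ ts σ τ)

    substs-⨾ : ∀ {n} (ts : Vec Term n) σ τ → substs (substs ts σ) τ ≡ substs ts (σ ⨾ τ)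
    substs-⨾ []       σ τ = refl
    substs-⨾ (t ∷ ts) σ τ = cong₂ _∷_ (⟨⟩-⨾ t σ τ) (substs-⨾ ts σ τ)

  substs-map : ∀ {n} (ts : Vec Term n) σ → substs ts σ ≡ Vec.map (_⟨ σ ⟩) ts
  substs-map []       σ = refl
  substs-map (t ∷ ts) σ = Eq.cong (t ⟨ σ ⟩ ∷_) (substs-map ts σ)

  lookup-substs : ∀ {n} (ts : Vec Term n) i σ → lookup (substs ts σ) i ≡ lookup ts i ⟨ σ ⟩
  lookup-substs ts i σ = trans (Eq.cong (λ vs → lookup vs i) (substs-map ts σ)) (lookup-map i _ ts)

  substs-[]≔ : ∀ {n} (ts : Vec Term n) i a σ → substs (ts [ i ]≔ a) σ ≡ substs ts σ [ i ]≔ a ⟨ σ ⟩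
  substs-[]≔ ts i a σ = begin
    substs (ts [ i ]≔ a) σ             ≡⟨ substs-map (ts [ i ]≔ a) σ ⟩
    Vec.map (_⟨ σ ⟩) (ts [ i ]≔ a)     ≡⟨ map-[]≔ (_⟨ σ ⟩) ts i ⟩
    Vec.map (_⟨ σ ⟩) ts [ i ]≔ a ⟨ σ ⟩ ≡⟨ Eq.cong (_[ i ]≔ a ⟨ σ ⟩) (sym (substs-map ts σ)) ⟩
    substs ts σ [ i ]≔ a ⟨ σ ⟩         ∎
    where open ≡-Reasoning

  toList-substs : ∀ {n} (ts : Vec Term n) σ → toList (substs ts σ) ≡ map (_⟨ σ ⟩) (toList ts)
  toList-substs ts σ = trans (Eq.cong toList (substs-map ts σ)) (toList-map _ ts)

  R⇒Step : ∀ {R t u} → R t u → Step R t u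
  R⇒Step {t = t} {u} r = subst₂ (Step _) (⟨⟩-var t) (⟨⟩-var u) (root var r)

  Step-stableSubst : ∀ {R} → StableSubst (Step R)
  Step-stableSubst σ (root {l} {r} τ lRr)
    rewrite ⟨⟩-⨾ l τ σ | ⟨⟩-⨾ r τ σ = root (τ ⨾ σ) lRr
  Step-stableSubst σ (cong {t} {u} f ts i t→u)
    rewrite substs-[]≔ ts i t σ | substs-[]≔ ts i u σ =
    cong f (substs ts σ) i (Step-stableSubst σ t→u)

  Step⁺-stableSubst : ∀ {R} → StableSubst (Step⁺ R)
  Step⁺-stableSubst σ [ s ]    = [ Step-stableSubst σ s ]
  Step⁺-stableSubst σ (s ∷ ss) = Step-stableSubst σ s ∷ Step⁺-stableSubst σ ss

  ▷₁-stableSubst : StableSubst _▷₁_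
  ▷₁-stableSubst σ (sub f ts i) =
    subst (app f (substs ts σ) ▷₁_) (lookup-substs ts i σ) (sub f (substs ts σ) i)

  ▷-stableSubst : StableSubst _▷_
  ▷-stableSubst σ [ s ]    = [ ▷₁-stableSubst σ s ]
  ▷-stableSubst σ (s ∷ ss) = ▷₁-stableSubst σ s ∷ ▷-stableSubst σ ss

  RedSub-stableSubst : ∀ {R} → StableSubst (RedSub R)
  RedSub-stableSubst σ (inj₁ t→u) = inj₁ (Step⁺-stableSubst σ t→u)
  RedSub-stableSubst σ (inj₂ t▷u) = inj₂ (▷-stableSubst σ t▷u)

  module _ {_>_ : Rel Term 0ℓ} (h : Term → Term) (h-mono : ∀ {a b} → a > b → h a > h b) where

    Lex-map : ∀ {xs ys} → Lex _>_ xs ys → Lex _>_ (map h xs) (map h ys)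
    Lex-map (here a>b)    = here (h-mono a>b)
    Lex-map (there xs>ys) = there (Lex-map xs>ys)

    LexDirected-map : ∀ {xs ys} → LexDirected _>_ xs ys → LexDirected _>_ (map h xs) (map h ys)
    LexDirected-map {xs} {ys} xs>ys with lexDir
    ... | left-to-right = Lex-map xs>ys
    ... | right-to-left = subst₂ (Lex _>_) (reverse-map h xs) (reverse-map h ys) (Lex-map xs>ys)

    Mul-map : ∀ {xs ys} → Mul _>_ xs ys → Mul _>_ (map h xs) (map h ys)
    Mul-map (X , Y , Z , xs↭X++Z , ys↭Y++Z , X≢[] , dominated) =
      map h X , map h Y , map h Z ,
      subst (_ ↭_) (map-++ h X Z) (map⁺ h xs↭X++Z) ,
      subst (_ ↭_) (map-++ h Y Z) (map⁺ h ys↭Y++Z) ,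
      map≢[] X X≢[] , dominated-map
      where
      map≢[] : ∀ X → ¬ X ≡ [] → ¬ map h X ≡ []
      map≢[] []      X≢[] _  = X≢[] refl
      map≢[] (_ ∷ _) _    ()

      dominated-map : ∀ {y} → y ∈ map h Y → Σ Term λ x → x ∈ map h X × x > y
      dominated-map y∈hY with ∈-map⁻ h y∈hY
      ... | y , y∈Y , refl with dominated y∈Y
      ... | x , x∈X , x>y = h x , ∈-map⁺ h x∈X , h-mono x>y

    Ext-map : ∀ s {xs ys} → Ext s _>_ xs ys → Ext s _>_ (map h xs) (map h ys)
    Ext-map lex = LexDirected-map
    Ext-map mul = Mul-map

  module _ {_>_ : Rel Term 0ℓ} {a b : Term} (a>b : a > b) where

    Lex-replace : ∀ P Q → Lex _>_ (P ++ a ∷ Q) (P ++ b ∷ Q)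
    Lex-replace []      Q = here a>b
    Lex-replace (_ ∷ P) Q = there (Lex-replace P Q)

    LexDirected-replace : ∀ P Q → LexDirected _>_ (P ++ a ∷ Q) (P ++ b ∷ Q)
    LexDirected-replace P Q with lexDir
    ... | left-to-right = Lex-replace P Q
    ... | right-to-left = subst₂ (Lex _>_) (sym (reverse-++-∷ a)) (sym (reverse-++-∷ b))
                            (Lex-replace (reverse Q) (reverse P))
      where
      reverse-++-∷ : ∀ x → reverse (P ++ x ∷ Q) ≡ reverse Q ++ x ∷ reverse P
      reverse-++-∷ x = begin
        reverse (P ++ x ∷ Q)               ≡⟨ reverse-++ P (x ∷ Q) ⟩
        reverse (x ∷ Q) ++ reverse P       ≡⟨ Eq.cong (_++ reverse P) (unfold-reverse x Q) ⟩
        (reverse Q ++ x ∷ []) ++ reverse P ≡⟨ ++-assoc (reverse Q) (x ∷ []) (reverse P) ⟩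
        reverse Q ++ x ∷ reverse P         ∎
        where open ≡-Reasoning

    Mul-replace : ∀ P Q → Mul _>_ (P ++ a ∷ Q) (P ++ b ∷ Q)
    Mul-replace P Q = a ∷ [] , b ∷ [] , P ++ Q , shift a P Q , shift b P Q , (λ ()) , dominated
      where
      dominated : ∀ {y} → y ∈ b ∷ [] → Σ Term λ x → x ∈ a ∷ [] × x > y
      dominated (here refl) = a , here refl , a>b

    Ext-replace : ∀ s P Q → Ext s _>_ (P ++ a ∷ Q) (P ++ b ∷ Q)
    Ext-replace lex = LexDirected-replace
    Ext-replace mul = Mul-replace

  toList-[]≔-split : ∀ {A : Set} {n} (xs : Vec A n) i →
                     Σ (List A) λ P → Σ (List A) λ Q → ∀ x → toList (xs [ i ]≔ x) ≡ P ++ x ∷ Q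
  toList-[]≔-split (y ∷ xs) zero    = [] , toList xs , λ x → refl
  toList-[]≔-split (y ∷ xs) (suc i) with toList-[]≔-split xs i
  ... | P , Q , split = y ∷ P , Q , λ x → Eq.cong (y ∷_) (split x)

  module _ {R : Rel Term 0ℓ} where

    mutual
      CC-stableSubst : ∀ {f ts u} σ → CC R f ts u → CC R f (substs ts σ) (u ⟨ σ ⟩)
      CC-stableSubst {ts = ts} σ (arg i) = subst (CC R _ _) (lookup-substs ts i σ) (arg i)
      CC-stableSubst σ (decomp {us = us} c i) =
        subst (CC R _ _) (lookup-substs us i σ) (decomp (CC-stableSubst σ c) i)
      CC-stableSubst σ (prec us f>g cs) =
        prec (substs us σ) f>g (CC-stableSubst-args σ us cs)
      CC-stableSubst {f} {ts} σ (call us f≃g cs ts>us) =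
        call (substs us σ) f≃g (CC-stableSubst-args σ us cs)
          (subst₂ (Ext (stat f) (RedSub R)) (sym (toList-substs ts σ)) (sym (toList-substs us σ))
            (Ext-map (_⟨ σ ⟩) (RedSub-stableSubst σ) (stat f) ts>us))
      CC-stableSubst σ (red c u→v) = red (CC-stableSubst σ c) (Step⁺-stableSubst σ u→v)

      CC-stableSubst-args : ∀ {f ts g} σ (us : Vec Term (arity g)) →
                            (∀ i → CC R f ts (lookup us i)) →
                            ∀ i → CC R f (substs ts σ) (lookup (substs us σ) i)
      CC-stableSubst-args σ us cs i =
        subst (CC R _ _) (sym (lookup-substs us i σ)) (CC-stableSubst σ (cs i))

    CR-stableSubst : StableSubst (CR R)
    CR-stableSubst σ (cr c) = cr (CC-stableSubst σ c)

    CR-R-trans : ∀ {t u v} → CR R t u → R u v → CR R t v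
    CR-R-trans (cr c) uRv = cr (red c [ R⇒Step uRv ])

    CC-▷ : ∀ {f ts u w} → CC R f ts u → u ▷ w → CC R f ts w
    CC-▷ c [ sub g us i ]     = decomp c i
    CC-▷ c (sub g us i ∷ u▷w) = CC-▷ (decomp c i) u▷w

    ▷⇒CR : ∀ {t u} → t ▷ u → CR R t u
    ▷⇒CR [ sub f ts i ]     = cr (arg i)
    ▷⇒CR (sub f ts i ∷ u▷w) = cr (CC-▷ (arg i) u▷w)

    CR-replace : ∀ f (ts : Vec Term (arity f)) i {a b} → Step⁺ R a b →
                 CR R (app f (ts [ i ]≔ a)) (app f (ts [ i ]≔ b))
    CR-replace f ts i {a} {b} a→b = cr (call (ts [ i ]≔ b) ≃F-refl replaced-args ts>us)
      where
      replaced-args : ∀ j → CC R f (ts [ i ]≔ a) (lookup (ts [ i ]≔ b) j)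
      replaced-args j with j ≟ i
      ... | yes refl = subst (CC R _ _) (sym (lookup∘update i ts b))
                         (red (subst (CC R _ _) (lookup∘update i ts a) (arg i)) a→b)
      ... | no j≢i   = subst (CC R _ _)
                         (trans (lookup∘update′ j≢i ts a) (sym (lookup∘update′ j≢i ts b))) (arg j)

      ts>us : Ext (stat f) (RedSub R) (toList (ts [ i ]≔ a)) (toList (ts [ i ]≔ b))
      ts>us with toList-[]≔-split ts i
      ... | P , Q , split rewrite split a | split b = Ext-replace (inj₁ a→b) (stat f) P Q

  >rco-trans : Transitive _>rco_
  >rco-trans (fix t>u) u>v = fix (CR-R-trans t>u u>v)

  >rco-stableSubst : StableSubst _>rco_
  >rco-stableSubst σ (fix t>u) = fix (CR-stableSubst σ t>u)

  >rco-stableCtx : StableCtx _>rco_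
  >rco-stableCtx hole            t>u = t>u
  >rco-stableCtx (node f ts i C) t>u = fix (CR-replace f ts i [ R⇒Step (>rco-stableCtx C t>u) ])

  ▷⇒>rco : ∀ {t u} → t ▷ u → t >rco u
  ▷⇒>rco t▷u = fix (▷⇒CR t▷u)

mainTheorem1 : (S : Setting) →
    Transitive (RCO._>rco_ S) ×
    RCO.StableSubst S (RCO._>rco_ S) ×
    RCO.StableCtx S (RCO._>rco_ S) ×
    (∀ {t u} → RCO._▷_ S t u → RCO._>rco_ S t u)
mainTheorem1 S = >rco-trans , >rco-stableSubst , >rco-stableCtx , ▷⇒>rco
  where open Properties S
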